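{- Let $\mathcal{A}$ be a deterministic parity automaton with state set $Q$, and let $u,v$ be nonempty finite strings over $Q$ with $v\equiv_{state}vv$ and $u\equiv_{state}uv$. Write $w=uv^\omega=q_1q_2\cdots$, let $n$ be the length of $u$, and let $S_u$ be the set of states that appear in $u$. Then for every $l\geq n$ the set of states appearing in $q_1\cdots q_l$ is $S_u$. Moreover, for all $l,l'>n$, if $q_l=q_{l'}$ then $q_1\cdots q_l\equiv_{state}q_1\cdots q_{l'}$.
   Context: A deterministic parity automaton is $\mathcal{A}=(Q,\Sigma,\delta,q_{init},pr)$ with finite state set $Q$, finite alphabet $\Sigma$, transition function $\delta:Q\times\Sigma\to Q$, initial state and priority function. A finite string $q_0\cdots q_k$ over $Q$ is a run of $\mathcal{A}$ if for each $i<k$ there is $\sigma\in\Sigma$ with $q_{i+1}=\delta(q_i,\sigma)$. For a string $x$, $x[m]$ is its $m$-th letter (positions from $0$) and $x[k,m)=\{x[i]:k\le i<m\}$. For nonempty finite strings $x,y$ over $Q$, $x\equiv_{state}y$ iff: (i) $x,y$ have the same first letter and the same last letter; (ii) for every position $m$ of $x$ there is a position $p$ of $y$ with $x[m]=y[p]$ and $x[0,m)=y[0,p)$; (iii) symmetrically with $x,y$ swapped; (iv) $x$ is a run of $\mathcal{A}$ iff $y$ is. -}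

module Defs where

open import Data.Nat using (ℕ; zero; suc; _+_; _∸_; _<_; _<?_; NonZero; _%_)
open import Data.Nat.DivMod using (m%n<n)
open import Data.Fin using (Fin; toℕ; fromℕ<)
open import Data.List using (List; length; lookup; take; head; last; applyUpTo)
open import Data.List.Membership.Propositional using (_∈_)
open import Data.List.Relation.Unary.Linked using (Linked)
open import Data.Product using (Σ; ∃; _×_)
open import Relation.Binary.PropositionalEquality using (_≡_)
open import Relation.Nullary using (yes; no)
open import Function.Bundles using (_⇔_)

record DPA : Set where
  field
    numStates  : ℕ
    numLetters : ℕ
    δ          : Fin numStates → Fin numLetters → Fin numStates
    qinit      : Fin numStates
    pr         : Fin numStates → ℕ
  Q : Set
  Q = Fin numStates

module _ (𝒜 : DPA) where
  open DPA 𝒜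

  Step : Q → Q → Set
  Step q q' = ∃ λ (σ : Fin numLetters) → δ q σ ≡ q'

  IsRun : List Q → Set
  IsRun = Linked Step

  _≡state_ : List Q → List Q → Set
  x ≡state y =
      (head x ≡ head y × last x ≡ last y)
    × ((m : Fin (length x)) → Σ (Fin (length y)) λ p →
          lookup x m ≡ lookup y p
          × (∀ q → (q ∈ take (toℕ m) x) ⇔ (q ∈ take (toℕ p) y)))
    × ((p : Fin (length y)) → Σ (Fin (length x)) λ m →
          lookup y p ≡ lookup x m
          × (∀ q → (q ∈ take (toℕ p) y) ⇔ (q ∈ take (toℕ m) x)))
    × (IsRun x ⇔ IsRun y)

-- the ω-word u v^ω, indexed from 0 (so q_{i+1} = omegaWord u v i)
omegaWord : {A : Set} (u v : List A) → .{{NonZero (length v)}} → ℕ → A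
omegaWord u v i with i <? length u
... | yes i<n = lookup u (fromℕ< i<n)
... | no _    = lookup v (fromℕ< (m%n<n (i ∸ length u) (length v)))

prefix : {A : Set} → (ℕ → A) → ℕ → List A
prefix w l = applyUpTo w l

-- Every position of u v^ω past u is a twin of a position inside u (same state, same set
-- of earlier states): apply clause (iii) of u ≡state uv to the copy of v, whose positions
-- represent all later ones by periodicity. So no new state appears after u, and two
-- positions past u with the same state see the same earlier states; this gives clauses
-- (i)–(iii) of ≡state. For (iv), u ≡state uv carries runs from u to uv, and v ≡state vv
-- supplies the transition from the end of v back to its start, so every prefix of length
-- at least |u| is a run iff u is.
module Submission where

open import Defs
open import Data.Nat using (ℕ; zero; suc; _+_; _*_; _∸_; _%_; _/_; _≤_; _<_; NonZero; pred; s≤s; z<s; s<s; >-nonZero⁻¹)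
open import Data.Nat.Properties
open import Data.Nat.DivMod using (m%n<n; m%n%n≡m%n; [m+n]%n≡m%n; [m+kn]%n≡m%n; m<n⇒m%n≡m; m≡m%n+[m/n]*n)
open import Data.Fin using (Fin; toℕ; fromℕ<)
open import Data.Fin.Properties using (toℕ-fromℕ<; fromℕ<-cong; toℕ<n)
open import Data.List using (List; []; _∷_; _++_; length; lookup; take; last; applyUpTo)
open import Data.List.Properties using (length-applyUpTo; lookup-applyUpTo)
open import Data.List.Membership.Propositional using (_∈_)
open import Data.List.Membership.Propositional.Properties using (∈-applyUpTo⁺; ∈-applyUpTo⁻)
import Data.List.Relation.Unary.Linked as Linked
open Linked using (Linked; _∷_)
open import Data.List.Relation.Unary.Linked.Properties using (applyUpTo⁺₁)
open import Data.Maybe using (just)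
open import Data.Sum using (inj₁; inj₂)
open import Data.Product using (Σ; ∃-syntax; _×_; _,_; proj₁; proj₂)
open import Relation.Nullary using (yes; no)
open import Relation.Nullary.Negation using (contradiction)
open import Relation.Binary.PropositionalEquality using (_≡_; refl; sym; trans; cong; cong₂; subst; subst₂; module ≡-Reasoning)
open import Function using (_∘_; _⇔_; mk⇔; Equivalence)
import Function.Properties.Equivalence as ⇔

open Equivalence using (to; from)

private
  variable
    A : Set
    R : A → A → Set
    i j l l' : ℕ

take-applyUpTo : (f : ℕ → A) {m n : ℕ} → m ≤ n → take m (applyUpTo f n) ≡ applyUpTo f m
take-applyUpTo f {zero}  _         = refl
take-applyUpTo f {suc m} (s≤s m≤n) = cong (f 0 ∷_) (take-applyUpTo (f ∘ suc) m≤n)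

applyUpTo-++ : (f : ℕ → A) (m n : ℕ) → applyUpTo f (m + n) ≡ applyUpTo f m ++ applyUpTo (f ∘ (m +_)) n
applyUpTo-++ f zero    n = refl
applyUpTo-++ f (suc m) n = cong (f 0 ∷_) (applyUpTo-++ (f ∘ suc) m n)

applyUpTo-lookup : (f : ℕ → A) (xs : List A) → (∀ {i} (i<n : i < length xs) → f i ≡ lookup xs (fromℕ< i<n))
                 → applyUpTo f (length xs) ≡ xs
applyUpTo-lookup f []       _    = refl
applyUpTo-lookup f (x ∷ xs) f≗xs = cong₂ _∷_ (f≗xs z<s) (applyUpTo-lookup (f ∘ suc) xs (f≗xs ∘ s<s))

last-applyUpTo : (f : ℕ → A) (n : ℕ) → last (applyUpTo f (suc n)) ≡ just (f n)
last-applyUpTo f zero    = refl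
last-applyUpTo f (suc n) = last-applyUpTo (f ∘ suc) n

toℕ<-applyUpTo : (f : ℕ → A) (n : ℕ) (i : Fin (length (applyUpTo f n))) → toℕ i < n
toℕ<-applyUpTo f n i = subst (toℕ i <_) (length-applyUpTo f n) (toℕ<n i)

fromℕ<-applyUpTo : (f : ℕ → A) (n : ℕ) → i < n → Fin (length (applyUpTo f n))
fromℕ<-applyUpTo f n i<n = fromℕ< (subst (_ <_) (sym (length-applyUpTo f n)) i<n)

LinkedUpTo : (A → A → Set) → (ℕ → A) → ℕ → Set
LinkedUpTo R f n = ∀ {i} → suc i < n → R (f i) (f (suc i))

Linked-applyUpTo : (f : ℕ → A) (n : ℕ) → Linked R (applyUpTo f n) ⇔ LinkedUpTo R f n
Linked-applyUpTo f n = mk⇔ (applyUpTo⁻ f n) (applyUpTo⁺₁ f n)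
  where
  applyUpTo⁻ : (f : ℕ → A) (n : ℕ) → Linked R (applyUpTo f n) → LinkedUpTo R f n
  applyUpTo⁻ f (suc zero)    _        (s≤s ())
  applyUpTo⁻ f (suc (suc n)) (r ∷ _)  {zero}  _         = r
  applyUpTo⁻ f (suc (suc n)) (_ ∷ rs) {suc i} (s<s i<n) = applyUpTo⁻ (f ∘ suc) (suc n) rs i<n

Linked-++⁻ʳ : (xs : List A) {ys : List A} → Linked R (xs ++ ys) → Linked R ys
Linked-++⁻ʳ []       r = r
Linked-++⁻ʳ (x ∷ xs) r = Linked-++⁻ʳ xs (Linked.tail r)

PositionsMatch : List A → List A → Set
PositionsMatch xs ys = (m : Fin (length xs)) → Σ (Fin (length ys)) λ p →
  lookup xs m ≡ lookup ys p × (∀ q → (q ∈ take (toℕ m) xs) ⇔ (q ∈ take (toℕ p) ys))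

Twins : (ℕ → A) → ℕ → ℕ → Set
Twins f m p = f m ≡ f p × (∀ q → (q ∈ applyUpTo f m) ⇔ (q ∈ applyUpTo f p))

Twinned : (ℕ → A) → ℕ → ℕ → Set
Twinned f l l' = ∀ {m} → m < l → ∃[ p ] p < l' × Twins f m p

module _ (f : ℕ → A) (l l' : ℕ) where

  twins⇔lookup-take : (m : Fin (length (applyUpTo f l))) (p : Fin (length (applyUpTo f l'))) →
    Twins f (toℕ m) (toℕ p) ⇔
    (lookup (applyUpTo f l) m ≡ lookup (applyUpTo f l') p
      × (∀ q → (q ∈ take (toℕ m) (applyUpTo f l)) ⇔ (q ∈ take (toℕ p) (applyUpTo f l'))))
  twins⇔lookup-take m p
    rewrite lookup-applyUpTo f l m | lookup-applyUpTo f l' p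
          | take-applyUpTo f (<⇒≤ (toℕ<-applyUpTo f l m))
          | take-applyUpTo f (<⇒≤ (toℕ<-applyUpTo f l' p)) = ⇔.refl

  positionsMatch⇔twinned : PositionsMatch (applyUpTo f l) (applyUpTo f l') ⇔ Twinned f l l'
  positionsMatch⇔twinned = mk⇔ toTwinned fromTwinned
    where
    toTwinned : PositionsMatch (applyUpTo f l) (applyUpTo f l') → Twinned f l l'
    toTwinned match {m} m<l = toℕ p , toℕ<-applyUpTo f l' p ,
      subst (λ m → Twins f m (toℕ p)) (toℕ-fromℕ< _) (from (twins⇔lookup-take m′ p) (proj₂ (match m′)))
      where
      m′ : Fin (length (applyUpTo f l))
      m′ = fromℕ<-applyUpTo f l m<l
      p : Fin (length (applyUpTo f l'))
      p = proj₁ (match m′)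

    fromTwinned : Twinned f l l' → PositionsMatch (applyUpTo f l) (applyUpTo f l')
    fromTwinned twinned m with twinned (toℕ<-applyUpTo f l m)
    ... | p , p<l' , twins = p′ , to (twins⇔lookup-take m p′)
      (subst (Twins f (toℕ m)) (sym (toℕ-fromℕ< _)) twins)
      where
      p′ : Fin (length (applyUpTo f l'))
      p′ = fromℕ<-applyUpTo f l' p<l'

module _ (v : List A) .{{_ : NonZero (length v)}} where
  private
    k : ℕ
    k = length v

  omegaWord[]-cong-% : i % k ≡ j % k → omegaWord [] v i ≡ omegaWord [] v j
  omegaWord[]-cong-% {i} {j} eq = cong (lookup v) (fromℕ<-cong _ _ eq (m%n<n i k) (m%n<n j k))

  omegaWord[]-< : (j<k : j < k) → omegaWord [] v j ≡ lookup v (fromℕ< j<k)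
  omegaWord[]-< {j} j<k = cong (lookup v) (fromℕ<-cong _ _ (m<n⇒m%n≡m j<k) (m%n<n j k) j<k)

  omegaWord[]-% : omegaWord [] v j ≡ omegaWord [] v (j % k)
  omegaWord[]-% {j} = omegaWord[]-cong-% (sym (m%n%n≡m%n j k))

  omegaWord[]-periodic : omegaWord [] v (k + j) ≡ omegaWord [] v j
  omegaWord[]-periodic {j} = omegaWord[]-cong-% (trans (cong (_% k) (+-comm k j)) ([m+n]%n≡m%n j k))

  omegaWord[]-suc-% : omegaWord [] v (suc j) ≡ omegaWord [] v (suc (j % k))
  omegaWord[]-suc-% {j} = omegaWord[]-cong-% (begin
    suc j % k                     ≡⟨ cong (λ x → suc x % k) (m≡m%n+[m/n]*n j k) ⟩
    (suc (j % k) + j / k * k) % k ≡⟨ [m+kn]%n≡m%n (suc (j % k)) (j / k) k ⟩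
    suc (j % k) % k               ∎)
    where open ≡-Reasoning

  applyUpTo-omegaWord[] : applyUpTo (omegaWord [] v) k ≡ v
  applyUpTo-omegaWord[] = applyUpTo-lookup (omegaWord [] v) v omegaWord[]-<

  applyUpTo-omegaWord[]-twice : applyUpTo (omegaWord [] v) (k + k) ≡ v ++ v
  applyUpTo-omegaWord[]-twice = begin
    applyUpTo (omegaWord [] v) (k + k)
      ≡⟨ applyUpTo-++ (omegaWord [] v) k k ⟩
    applyUpTo (omegaWord [] v) k ++ applyUpTo (omegaWord [] v ∘ (k +_)) k
      ≡⟨ cong₂ _++_ applyUpTo-omegaWord[] (applyUpTo-lookup _ v (λ j<k → trans omegaWord[]-periodic (omegaWord[]-< j<k))) ⟩
    v ++ v ∎
    where open ≡-Reasoning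

  -- A step of v^ω at position j is the step at j % k, which lies inside v v.
  Linked-omegaWord[] : Linked R (v ++ v) → ∀ j → R (omegaWord [] v j) (omegaWord [] v (suc j))
  Linked-omegaWord[] {R = R} linked j =
    subst₂ R (sym omegaWord[]-%) (sym omegaWord[]-suc-%) (steps (≤-<-trans (m%n<n j k) (m<m+n k (>-nonZero⁻¹ k))))
    where
    steps : LinkedUpTo R (omegaWord [] v) (k + k)
    steps = to (Linked-applyUpTo _ (k + k)) (subst (Linked R) (sym applyUpTo-omegaWord[]-twice) linked)

module _ (u v : List A) .{{_ : NonZero (length v)}} where
  private
    n k : ℕ
    n = length u
    k = length v
    w : ℕ → A
    w = omegaWord u v

  omegaWord-< : (i<n : i < n) → w i ≡ lookup u (fromℕ< i<n)
  omegaWord-< {i} i<n with i <? n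
  ... | yes i<n′ = cong (lookup u) (fromℕ<-cong i i refl i<n′ i<n)
  ... | no  i≮n  = contradiction i<n i≮n

  omegaWord-≥ : n ≤ i → w i ≡ omegaWord [] v (i ∸ n)
  omegaWord-≥ {i} n≤i with i <? n
  ... | yes i<n = contradiction n≤i (<⇒≱ i<n)
  ... | no  _   = refl

  omegaWord-+ : w (n + j) ≡ omegaWord [] v j
  omegaWord-+ {j} = trans (omegaWord-≥ (m≤m+n n j)) (cong (omegaWord [] v) (m+n∸m≡n n j))

  omegaWord-≥-% : n ≤ i → w i ≡ w (n + (i ∸ n) % k)
  omegaWord-≥-% n≤i = trans (omegaWord-≥ n≤i) (trans (omegaWord[]-% v) (sym omegaWord-+))

  applyUpTo-omegaWord-u : applyUpTo w n ≡ u
  applyUpTo-omegaWord-u = applyUpTo-lookup w u omegaWord-<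

  applyUpTo-omegaWord-uv : applyUpTo w (n + k) ≡ u ++ v
  applyUpTo-omegaWord-uv = trans (applyUpTo-++ w n k)
    (cong₂ _++_ applyUpTo-omegaWord-u (applyUpTo-lookup _ v (λ j<k → trans omegaWord-+ (omegaWord[]-< v j<k))))

  Linked-omegaWord : (Linked R u → Linked R (u ++ v)) → (Linked R v → Linked R (v ++ v))
                   → n ≤ l → Linked R (applyUpTo w l) ⇔ Linked R u
  Linked-omegaWord {R = R} {l = l} u⇒uv v⇒vv n≤l = mk⇔
    (λ linked → subst (Linked R) applyUpTo-omegaWord-u
                  (from (Linked-applyUpTo w n) (λ i<n → to (Linked-applyUpTo w l) linked (<-≤-trans i<n n≤l))))
    (λ linked → from (Linked-applyUpTo w l) (λ {i} _ → step linked i))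
    where
    step : Linked R u → ∀ i → R (w i) (w (suc i))
    step linked i with <-≤-connex i n
    ... | inj₁ i<n = to (Linked-applyUpTo w (n + k)) (subst (Linked R) (sym applyUpTo-omegaWord-uv) (u⇒uv linked))
                      (≤-<-trans i<n (m<m+n n (>-nonZero⁻¹ k)))
    ... | inj₂ n≤i = subst₂ R (sym (omegaWord-≥ n≤i)) (sym w-suc)
                      (Linked-omegaWord[] v (v⇒vv (Linked-++⁻ʳ u (u⇒uv linked))) (i ∸ n))
      where
      w-suc : w (suc i) ≡ omegaWord [] v (suc (i ∸ n))
      w-suc = trans (omegaWord-≥ (m≤n⇒m≤1+n n≤i)) (cong (omegaWord [] v) (+-∸-assoc 1 n≤i))

  module _ (twinned-uv : Twinned w (n + k) n) where

    omegaWord-∈-u : ∀ i → w i ∈ applyUpTo w n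
    omegaWord-∈-u i with <-≤-connex i n
    ... | inj₁ i<n = ∈-applyUpTo⁺ w i<n
    ... | inj₂ n≤i with twinned-uv (+-monoʳ-< n (m%n<n (i ∸ n) k))
    ...   | m , m<n , w≡ , _ = subst (_∈ applyUpTo w n) (sym (trans (omegaWord-≥-% n≤i) w≡)) (∈-applyUpTo⁺ w m<n)

    ∈-applyUpTo-omegaWord-saturates : n ≤ l → ∀ q → (q ∈ applyUpTo w l) ⇔ (q ∈ applyUpTo w n)
    ∈-applyUpTo-omegaWord-saturates {l} n≤l q = mk⇔ shrink grow
      where
      shrink : q ∈ applyUpTo w l → q ∈ applyUpTo w n
      shrink q∈ with ∈-applyUpTo⁻ w q∈
      ... | i , _ , refl = omegaWord-∈-u i

      grow : q ∈ applyUpTo w n → q ∈ applyUpTo w l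
      grow q∈ with ∈-applyUpTo⁻ w q∈
      ... | i , i<n , refl = ∈-applyUpTo⁺ w (<-≤-trans i<n n≤l)

    twin-in-u : ∀ i → ∃[ m ] m < n × Twins w i m
    twin-in-u i with <-≤-connex i n
    ... | inj₁ i<n = i , i<n , refl , λ _ → ⇔.refl
    ... | inj₂ n≤i with twinned-uv (+-monoʳ-< n (m%n<n (i ∸ n) k))
    ...   | m , m<n , w≡ , seen≡ = m , m<n , trans (omegaWord-≥-% n≤i) w≡ , λ q →
      ⇔.trans (∈-applyUpTo-omegaWord-saturates n≤i q)
        (⇔.trans (⇔.sym (∈-applyUpTo-omegaWord-saturates (m≤m+n n _) q)) (seen≡ q))

    twinned-omegaWord : n ≤ l' → Twinned w l l'
    twinned-omegaWord n≤l' {m} _ with twin-in-u m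
    ... | p , p<n , twins = p , <-≤-trans p<n n≤l' , twins

lemma5p11 : (𝒜 : DPA) (u v : List (DPA.Q 𝒜))
    → NonZero (length u) → .{{_ : NonZero (length v)}}
    → _≡state_ 𝒜 v (v ++ v) → _≡state_ 𝒜 u (u ++ v)
    → ((l : ℕ) → length u ≤ l
         → ∀ q → (q ∈ prefix (omegaWord u v) l) ⇔ (q ∈ u))
      × ((l l' : ℕ) → length u < l → length u < l'
         → omegaWord u v (pred l) ≡ omegaWord u v (pred l')
         → _≡state_ 𝒜 (prefix (omegaWord u v) l) (prefix (omegaWord u v) l'))
lemma5p11 𝒜 u v _ (_ , _ , _ , run-v) (_ , _ , match-uv , run-u) = seen-saturates , prefixes-≡state
  where
  w : ℕ → DPA.Q 𝒜
  w = omegaWord u v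

  twinned-uv : Twinned w (length u + length v) (length u)
  twinned-uv = to (positionsMatch⇔twinned w _ _)
    (subst₂ PositionsMatch (sym (applyUpTo-omegaWord-uv u v)) (sym (applyUpTo-omegaWord-u u v)) match-uv)

  isRun⇔u : length u ≤ l → IsRun 𝒜 (applyUpTo w l) ⇔ IsRun 𝒜 u
  isRun⇔u = Linked-omegaWord u v (to run-u) (to run-v)

  seen-saturates : (l : ℕ) → length u ≤ l → ∀ q → (q ∈ applyUpTo w l) ⇔ (q ∈ u)
  seen-saturates l n≤l q = subst (λ xs → (q ∈ applyUpTo w l) ⇔ (q ∈ xs)) (applyUpTo-omegaWord-u u v)
    (∈-applyUpTo-omegaWord-saturates u v twinned-uv n≤l q)

  prefixes-≡state : (l l' : ℕ) → length u < l → length u < l' → w (pred l) ≡ w (pred l')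
                  → _≡state_ 𝒜 (applyUpTo w l) (applyUpTo w l')
  prefixes-≡state (suc l) (suc l') n<l n<l' w≡ =
      (refl , trans (last-applyUpTo w l) (trans (cong just w≡) (sym (last-applyUpTo w l'))))
    , from (positionsMatch⇔twinned w _ _) (twinned-omegaWord u v twinned-uv (<⇒≤ n<l'))
    , from (positionsMatch⇔twinned w _ _) (twinned-omegaWord u v twinned-uv (<⇒≤ n<l))
    , ⇔.trans (isRun⇔u (<⇒≤ n<l)) (⇔.sym (isRun⇔u (<⇒≤ n<l')))
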